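{- Let $G$ be a graph. Then $b(G)\le b_L(G)+1$.
   Context: For a finite simple graph $H$, a burning sequence is a sequence $(b_1,\dots,b_t)$ of vertices such that every vertex $v$ satisfies $d_H(v,b_i)\le t-i$ for some $i\in\{1,\dots,t\}$; $b(H)$ is the minimum length of a burning sequence. The line graph $L(G)$ has vertex set $E(G)$, two vertices adjacent iff the edges share an endpoint. The edge burning number of $G$ is $b_L(G)=b(L(G))$ (the minimum number of steps to burn all edges of $G$ when at each step one new edge is set on fire and fire spreads from burned edges to edges sharing an endpoint). -}

module Defs where

open import Data.Nat using (ℕ; zero; suc; _∸_; _≤_; _<_)
open import Data.Fin using (Fin; toℕ)
open import Data.Product using (Σ; ∃; _×_; _,_)
open import Data.Sum using (_⊎_)
open import Relation.Binary.PropositionalEquality using (_≡_)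
open import Relation.Nullary using (¬_)

record SimpleGraph (n : ℕ) : Set₁ where
  field
    Adj   : Fin n → Fin n → Set
    sym   : ∀ {u v} → Adj u v → Adj v u
    irrefl : ∀ {v} → ¬ Adj v v
open SimpleGraph public

-- Reach A k u v : there is a walk from u to v of length at most k,
-- i.e. d(u,v) ≤ k in the graph with adjacency A.
data Reach {V : Set} (A : V → V → Set) : ℕ → V → V → Set where
  here : ∀ {k} v → Reach A k v v
  step : ∀ {k u w v} → A u w → Reach A k w v → Reach A (suc k) u v

-- (b_1,…,b_t) is a burning sequence; index i : Fin t stands for b_{i+1},
-- so the radius condition d(v, b_{i+1}) ≤ t - (i+1).
IsBurningSeq : {V : Set} (A : V → V → Set) (t : ℕ) → (Fin t → V) → Set
IsBurningSeq {V} A t b = ∀ (v : V) → ∃ λ (i : Fin t) → Reach A (t ∸ suc (toℕ i)) (b i) v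

BurningNumber : {V : Set} (A : V → V → Set) → ℕ → Set
BurningNumber {V} A t =
  (Σ (Fin t → V) λ b → IsBurningSeq A t b)
  × (∀ (s : ℕ) (b : Fin s → V) → IsBurningSeq A s b → t ≤ s)

-- Edges of G: pairs u < v (as naturals) with u adjacent to v (each edge once).
record Edge {n : ℕ} (G : SimpleGraph n) : Set where
  constructor edge
  field
    end₁ : Fin n
    end₂ : Fin n
    ordered : toℕ end₁ < toℕ end₂
    adj : Adj G end₁ end₂
open Edge public

ShareEnd : ∀ {n} {G : SimpleGraph n} → Edge G → Edge G → Set
ShareEnd e f =
  (end₁ e ≡ end₁ f) ⊎ (end₁ e ≡ end₂ f) ⊎ (end₂ e ≡ end₁ f) ⊎ (end₂ e ≡ end₂ f)

LineAdj : ∀ {n} (G : SimpleGraph n) → Edge G → Edge G → Set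
LineAdj G e f = ¬ ((end₁ e ≡ end₁ f) × (end₂ e ≡ end₂ f)) × ShareEnd e f

Connected : ∀ {n} → SimpleGraph n → Set
Connected {n} G = ∀ (u v : Fin n) → ∃ λ k → Reach (Adj G) k u v

-- A walk of length k in the line graph from e to f lifts to a walk of length
-- at most k + 1 in G between any endpoint of e and any endpoint of f. So if the
-- edges e₁,…,e_t burn L(G), the vertices end₁(e₁),…,end₁(e_t) followed by an
-- arbitrary vertex r burn G in t + 1 steps: the extra step buys the extra unit
-- of radius, and connectivity guarantees that every vertex other than r lies
-- on an edge.
module Submission where

open import Defs
open import Data.Nat using (ℕ; zero; suc; _≤_; _+_; _∸_; z≤n)
open import Data.Nat.Properties using (<-cmp; +-comm; +-∸-comm; ≤-trans)
open import Data.Fin using (Fin; toℕ; _↑ˡ_; _↑ʳ_) renaming (zero to fzero)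
open import Data.Fin.Properties using (toℕ-↑ˡ; toℕ<n; toℕ-injective)
open import Data.Vec.Functional using (_++_)
open import Data.Vec.Functional.Properties using (lookup-++ˡ; lookup-++ʳ)
open import Data.Product using (∃; _×_; _,_)
open import Data.Sum using (_⊎_; inj₁; inj₂)
open import Data.Empty using (⊥-elim)
open import Function using (_∘_)
open import Relation.Binary using (tri<; tri≈; tri>)
open import Relation.Binary.PropositionalEquality
  using (_≡_; refl; subst; cong; module ≡-Reasoning)
  renaming (sym to ≡-sym)

module _ {V : Set} {A : V → V → Set} where

  reach-suc : ∀ {k u v} → Reach A k u v → Reach A (suc k) u v
  reach-suc (here v)   = here v
  reach-suc (step a r) = step a (reach-suc r)

  step-or-stay : ∀ {k x y z} → (x ≡ y) ⊎ A x y → Reach A k y z → Reach A (suc k) x z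
  step-or-stay (inj₁ refl) r = reach-suc r
  step-or-stay (inj₂ a)    r = step a r

module _ {n : ℕ} (G : SimpleGraph n) where

  IsEndpoint : Edge G → Fin n → Set
  IsEndpoint e x = (x ≡ end₁ e) ⊎ (x ≡ end₂ e)

  endpoints-equal-or-adjacent : ∀ e {x y} → IsEndpoint e x → IsEndpoint e y → (x ≡ y) ⊎ Adj G x y
  endpoints-equal-or-adjacent e (inj₁ refl) (inj₁ refl) = inj₁ refl
  endpoints-equal-or-adjacent e (inj₁ refl) (inj₂ refl) = inj₂ (adj e)
  endpoints-equal-or-adjacent e (inj₂ refl) (inj₁ refl) = inj₂ (SimpleGraph.sym G (adj e))
  endpoints-equal-or-adjacent e (inj₂ refl) (inj₂ refl) = inj₁ refl

  shared-endpoint : ∀ e f → ShareEnd e f → ∃ λ c → IsEndpoint e c × IsEndpoint f c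
  shared-endpoint e f (inj₁ p)               = end₁ e , inj₁ refl , inj₁ p
  shared-endpoint e f (inj₂ (inj₁ p))        = end₁ e , inj₁ refl , inj₂ p
  shared-endpoint e f (inj₂ (inj₂ (inj₁ p))) = end₂ e , inj₂ refl , inj₁ p
  shared-endpoint e f (inj₂ (inj₂ (inj₂ p))) = end₂ e , inj₂ refl , inj₂ p

  lineReach⇒reach : ∀ {k e f x y} → Reach (LineAdj G) k e f →
                    IsEndpoint e x → IsEndpoint f y → Reach (Adj G) (suc k) x y
  lineReach⇒reach (here f) x∈f y∈f =
    step-or-stay (endpoints-equal-or-adjacent f x∈f y∈f) (here _)
  lineReach⇒reach (step {u = e} {w = g} (_ , e~g) r) x∈e y∈f with shared-endpoint e g e~g
  ... | c , c∈e , c∈g =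
    step-or-stay (endpoints-equal-or-adjacent e x∈e c∈e) (lineReach⇒reach r c∈g y∈f)

  adjacent⇒incidentEdge : ∀ {v w} → Adj G v w → ∃ λ f → IsEndpoint f v
  adjacent⇒incidentEdge {v} {w} a with <-cmp (toℕ v) (toℕ w)
  ... | tri< v<w _ _ = edge v w v<w a , inj₁ refl
  ... | tri≈ _ v≡w _ = ⊥-elim (SimpleGraph.irrefl G (subst (Adj G v) (≡-sym (toℕ-injective v≡w)) a))
  ... | tri> _ _ w<v = edge w v w<v (SimpleGraph.sym G a) , inj₂ refl

  connected⇒root-or-nonIsolated : Connected G → ∀ r v → (v ≡ r) ⊎ ∃ (Adj G v)
  connected⇒root-or-nonIsolated con r v with con v r
  ... | _ , here _           = inj₁ refl
  ... | _ , step {w = w} a _ = inj₂ (w , a)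

radius-after-append : ∀ t (i : Fin t) → (t + 1) ∸ suc (toℕ (i ↑ˡ 1)) ≡ suc (t ∸ suc (toℕ i))
radius-after-append t i = begin
  (t + 1) ∸ suc (toℕ (i ↑ˡ 1)) ≡⟨ cong (λ j → (t + 1) ∸ suc j) (toℕ-↑ˡ i 1) ⟩
  (t + 1) ∸ suc (toℕ i)        ≡⟨ +-∸-comm 1 (toℕ<n i) ⟩
  (t ∸ suc (toℕ i)) + 1        ≡⟨ +-comm _ 1 ⟩
  suc (t ∸ suc (toℕ i))        ∎
  where open ≡-Reasoning

lineBurningSeq⇒burningSeq :
  ∀ {n} (G : SimpleGraph n) (r : Fin n) → (∀ v → (v ≡ r) ⊎ ∃ (Adj G v)) →
  ∀ t (e : Fin t → Edge G) → IsBurningSeq (LineAdj G) t e →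
  IsBurningSeq (Adj G) (t + 1) ((end₁ ∘ e) ++ λ _ → r)
lineBurningSeq⇒burningSeq G r cover t e burns v with cover v
... | inj₁ refl = t ↑ʳ fzero ,
  subst (λ x → Reach (Adj G) _ x v) (≡-sym (lookup-++ʳ (end₁ ∘ e) (λ _ → r) fzero)) (here v)
... | inj₂ (_ , a) with adjacent⇒incidentEdge G a
... | f , v∈f with burns f
... | i , e↝f = i ↑ˡ 1 ,
  subst (λ x → Reach (Adj G) _ x v) (≡-sym (lookup-++ˡ (end₁ ∘ e) (λ _ → r) i))
    (subst (λ k → Reach (Adj G) k (end₁ (e i)) v) (≡-sym (radius-after-append t i))
      (lineReach⇒reach G e↝f (inj₁ refl) v∈f))

lemma5 : ∀ {n : ℕ} (G : SimpleGraph n) → Connected G →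
           ∀ (bG bL : ℕ) → BurningNumber (Adj G) bG → BurningNumber (LineAdj G) bL →
           bG ≤ bL + 1
lemma5 {zero} _ _ bG _ (_ , minimalG) _ = ≤-trans (minimalG 0 (λ ()) (λ ())) z≤n
lemma5 {suc _} G con bG bL (_ , minimalG) ((e , burns) , _) =
  minimalG (bL + 1) _
    (lineBurningSeq⇒burningSeq G fzero (connected⇒root-or-nonIsolated G con fzero) bL e burns)
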